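{- Let $\vec q = (q_0,\dots,q_{m-1})$ be a sequence of positive integers with $m\ge 1$ such that either $q_0 \ge 2$ and $q_{m-1}\ge 2$, or $q_0 = q_{m-1} = 1$. Then \[ \left|[\vec q]^{\star}\right| < \tfrac{1}{2}\,[q_0,\dots,q_{m-1}]. \]
   Context: Continuants: for a sequence of integers $q_0,\dots,q_{m-1}$ and $0\le i\le j+2\le m+1$, define $[q_i,\dots,q_j]$ recursively by $[q_i,\dots,q_{i-2}]=0$, $[q_i,\dots,q_{i-1}]=1$, and $[q_i,\dots,q_j] = q_j\,[q_i,\dots,q_{j-1}] + [q_i,\dots,q_{j-2}]$ for $j\ge i$. The anticontinuant of $\vec q$ is $[\vec q]^{\star} := [q_0,\dots,q_{m-2}] - [q_1,\dots,q_{m-1}]$. -}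

module Defs where

open import Data.Nat using (ℕ; zero; suc)
open import Data.Integer using (ℤ; +_; _+_; _*_; _-_)
open import Data.Product using (_×_; _,_; proj₁; proj₂)
open import Data.Vec using (Vec; []; _∷_; foldl; init; tail; head; last)

-- Continuant pair: for a list processed left to right, keep
-- ( [q_i..q_j] , [q_i..q_{j-1}] ), starting from ( [ ] = 1 , [q_i..q_{i-2}] = 0 ).
-- Step with q_j:  [q_i..q_j] = q_j * [q_i..q_{j-1}] + [q_i..q_{j-2}].
contStep : ℤ × ℤ → ℤ → ℤ × ℤ
contStep (a , b) q = (q * a + b , a)

continuant : ∀ {n} → Vec ℤ n → ℤ
continuant {n} v = proj₁ (foldl (λ _ → ℤ × ℤ) contStep (+ 1 , + 0) v)

anticontinuant : ∀ {m} → Vec ℤ (suc m) → ℤ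
anticontinuant v = continuant (init v) - continuant (tail v)

-- Write q = (x, u, y) with A = [x, u] (q without its last entry), B = [u, y] (q without its
-- first entry) and K = [q], so that [q]^⋆ = A - B.  The continuant satisfies two recursions,
-- one on the last entry, K = y·A + [x, u without its last entry], and one on the first entry,
-- K = x·B + [u, y without its first entry].
--   * Ends ≥ 2:  then 2A ≤ K and 2B ≤ K, and |A - B| < max(A, B) as A, B ≥ 1.
--   * Ends = 1:  then K = A + A' = B + B' with 1 ≤ A' ≤ A and 1 ≤ B' ≤ B, hence
--     2A = K + (A - A') and 2B = K + (B - B'), so 2|A - B| = |(A - A') - (B - B')| < K.
module Submission where

open import Defs
open import Data.Nat using (ℕ; suc)
open import Data.Integer using (ℤ; +_; +[1+_]; _<_; _*_; ∣_∣; _≥_)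
open import Data.Vec using (Vec; head; last; map)
open import Data.Product using (_×_)
open import Data.Sum using (_⊎_)
open import Relation.Binary.PropositionalEquality using (_≡_)

open import Data.Nat using (zero; _+_; _≤_; _⊔_; ∣_-_∣; z≤n; s≤s)
  renaming (_*_ to _·_; _<_ to _<ℕ_)
open import Data.Nat.Properties
  using (≤-trans; m≤m+n; m<n+m; *-identityˡ; *-zeroʳ; *-monoˡ-≤;
         *-monoʳ-<; *-distribˡ-⊔; ⊔-lub; ∣m-n∣≤m⊔n; *-distribˡ-∣-∣; m≤n⇒∃[o]m+o≡n; module ≤-Reasoning)
open import Data.Nat.Tactic.RingSolver using (solve-∀)
open import Data.Integer as ℤ using (_⊖_; +≤+; +<+)
open import Data.Integer.Properties as ℤP using ([1+m]⊖[1+n]≡m⊖n; [+m]-[+n]≡m⊖n; pos-*; pos-+)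
open import Data.Vec using ([]; _∷_; _∷ʳ_; foldl; init; initLast)
open import Data.Vec.Properties using (foldl-∷ʳ; init-∷ʳ; last-∷ʳ; map-∷ʳ)
open import Data.Product using (_,_; proj₁; proj₂)
open import Data.Sum using (inj₁; inj₂)
open import Relation.Binary.PropositionalEquality using (refl; sym; trans; cong; cong₂; subst)

∣-∣<⊔ : ∀ {m n} → 1 ≤ m → 1 ≤ n → ∣ m - n ∣ <ℕ m ⊔ n
∣-∣<⊔ {suc m} {suc n} _ _ = s≤s (∣m-n∣≤m⊔n m n)

∣k+m-k+n∣≡∣m-n∣ : ∀ k m n → ∣ k + m - k + n ∣ ≡ ∣ m - n ∣
∣k+m-k+n∣≡∣m-n∣ zero    m n = refl
∣k+m-k+n∣≡∣m-n∣ (suc k) m n = ∣k+m-k+n∣≡∣m-n∣ k m n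

gap-outer : ∀ {A B K} → 1 ≤ A → 1 ≤ B → 2 · A ≤ K → 2 · B ≤ K → 2 · ∣ A - B ∣ <ℕ K
gap-outer {A} {B} {K} 1≤A 1≤B 2A≤K 2B≤K = begin-strict
  2 · ∣ A - B ∣  <⟨ *-monoʳ-< 2 (∣-∣<⊔ 1≤A 1≤B) ⟩
  2 · (A ⊔ B)    ≡⟨ *-distribˡ-⊔ 2 A B ⟩
  2 · A ⊔ 2 · B  ≤⟨ ⊔-lub 2A≤K 2B≤K ⟩
  K              ∎
  where open ≤-Reasoning

-- Second case of the argument: K = A + A' = B + B' with 1 ≤ A' ≤ A and 1 ≤ B' ≤ B.
-- Writing A = A' + a and B = B' + b gives 2A = K + a and 2B = K + b with a, b < K.
gap-inner : ∀ {A A' B B' K} → K ≡ A + A' → K ≡ B + B' →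
  1 ≤ A' → A' ≤ A → 1 ≤ B' → B' ≤ B → 2 · ∣ A - B ∣ <ℕ K
gap-inner {A' = A'} {B' = B'} {K} K≡A+A' K≡B+B' 1≤A' A'≤A 1≤B' B'≤B
  with m≤n⇒∃[o]m+o≡n A'≤A | m≤n⇒∃[o]m+o≡n B'≤B
... | a , refl | b , refl = begin-strict
  2 · ∣ A' + a - B' + b ∣          ≡⟨ *-distribˡ-∣-∣ 2 (A' + a) (B' + b) ⟩
  ∣ 2 · (A' + a) - 2 · (B' + b) ∣  ≡⟨ cong₂ ∣_-_∣ (double A' a K≡A+A') (double B' b K≡B+B') ⟩
  ∣ K + a - K + b ∣                ≡⟨ ∣k+m-k+n∣≡∣m-n∣ K a b ⟩
  ∣ a - b ∣                        ≤⟨ ∣m-n∣≤m⊔n a b ⟩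
  a ⊔ b                            <⟨ ⊔-lub (excess<K A' a K≡A+A' 1≤A') (excess<K B' b K≡B+B' 1≤B') ⟩
  K                                ∎
  where
  open ≤-Reasoning

  double : ∀ c d → K ≡ (c + d) + c → 2 · (c + d) ≡ K + d
  double c d K≡ = trans (regroup c d) (cong (_+ d) (sym K≡))
    where
    regroup : ∀ c d → 2 · (c + d) ≡ ((c + d) + c) + d
    regroup = solve-∀

  excess<K : ∀ c d → K ≡ (c + d) + c → 1 ≤ c → d <ℕ K
  excess<K c d K≡ 1≤c = begin-strict
    d            <⟨ m<n+m d 1≤c ⟩
    c + d        ≤⟨ m≤m+n (c + d) c ⟩
    (c + d) + c  ≡⟨ sym K≡ ⟩
    K            ∎

-- Continuants in ℕ.  The entry q stands for the positive integer q + 1.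

step : ℕ × ℕ → ℕ → ℕ × ℕ
step (a , b) q = (suc q · a + b , a)

run : ∀ {n} → ℕ × ℕ → Vec ℕ n → ℕ × ℕ
run s v = foldl (λ _ → ℕ × ℕ) step s v

K : ∀ {n} → Vec ℕ n → ℕ
K v = proj₁ (run (1 , 0) v)

-- K⁻ v = [v without its last entry]  (0 for the empty sequence).
K⁻ : ∀ {n} → Vec ℕ n → ℕ
K⁻ v = proj₂ (run (1 , 0) v)

-- Kᵗ v = [v without its first entry]  (0 for the empty sequence); starting from (0 , 1)
-- turns the first step into (1 , 0), as Kᵗ-∷ below records.
Kᵗ : ∀ {n} → Vec ℕ n → ℕ
Kᵗ v = proj₁ (run (0 , 1) v)

K-∷ʳ : ∀ {n} (w : Vec ℕ n) y → K (w ∷ʳ y) ≡ suc y · K w + K⁻ w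
K-∷ʳ w y = cong proj₁ (foldl-∷ʳ (λ _ → ℕ × ℕ) step (1 , 0) y w)

run-linear : ∀ {n} (v : Vec ℕ n) a b →
  run (a , b) v ≡ (a · K v + b · Kᵗ v , a · K⁻ v + b · proj₂ (run (0 , 1) v))
run-linear []      a b = cong₂ _,_ (regroup₁₀ a b) (regroup₀₁ a b)
  where
  regroup₁₀ : ∀ a b → a ≡ a · 1 + b · 0
  regroup₁₀ = solve-∀
  regroup₀₁ : ∀ a b → b ≡ a · 0 + b · 1
  regroup₀₁ = solve-∀
run-linear (q ∷ v) a b
  rewrite run-linear v (suc q · a + b) a
        | run-linear v (suc q · 1 + 0) 1
        | run-linear v (suc q · 0 + 1) 0
  = cong₂ _,_ (regroup q a b (K v) (Kᵗ v)) (regroup q a b (K⁻ v) (proj₂ (run (0 , 1) v)))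
  where
  regroup : ∀ q a b k l → (suc q · a + b) · k + a · l
          ≡ a · ((suc q · 1 + 0) · k + 1 · l) + b · ((suc q · 0 + 1) · k + 0 · l)
  regroup = solve-∀

K-∷ : ∀ {n} x (v : Vec ℕ n) → K (x ∷ v) ≡ suc x · K v + Kᵗ v
K-∷ x v = trans (cong proj₁ (run-linear v (suc x · 1 + 0) 1)) (regroup x (K v) (Kᵗ v))
  where
  regroup : ∀ x k l → (suc x · 1 + 0) · k + 1 · l ≡ suc x · k + l
  regroup = solve-∀

Kᵗ-∷ : ∀ {n} y (w : Vec ℕ n) → Kᵗ (y ∷ w) ≡ K w
Kᵗ-∷ y w = cong (λ c → proj₁ (run (c , 0) w)) (cong (_+ 1) (*-zeroʳ (suc y)))

-- A pair (a , b) with 1 ≤ b ≤ a stays so along the recursion, since a ≤ (q + 1)a + b.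
run-ordered : ∀ {n} (v : Vec ℕ n) {a b} → 1 ≤ b → b ≤ a →
  1 ≤ proj₂ (run (a , b) v) × proj₂ (run (a , b) v) ≤ proj₁ (run (a , b) v)
run-ordered []      1≤b b≤a = 1≤b , b≤a
run-ordered (q ∷ v) {a} {b} 1≤b b≤a =
  run-ordered v (≤-trans 1≤b b≤a) (≤-trans (m≤m+n a (q · a)) (m≤m+n (suc q · a) b))

-- After the first entry x the pair is (x + 1 , 1), which satisfies the invariant.
K⁻-pos : ∀ {n} x (v : Vec ℕ n) → 1 ≤ K⁻ (x ∷ v)
K⁻-pos x v = proj₁ (run-ordered v (s≤s z≤n) (s≤s z≤n))

K⁻≤K : ∀ {n} (v : Vec ℕ n) → K⁻ v ≤ K v
K⁻≤K []      = z≤n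
K⁻≤K (x ∷ v) = proj₂ (run-ordered v (s≤s z≤n) (s≤s z≤n))

K-pos : ∀ {n} (v : Vec ℕ n) → 1 ≤ K v
K-pos []      = s≤s z≤n
K-pos (x ∷ v) = ≤-trans (K⁻-pos x v) (K⁻≤K (x ∷ v))

Kᵗ-pos : ∀ {n} (v : Vec ℕ (suc n)) → 1 ≤ Kᵗ v
Kᵗ-pos (y ∷ w) = subst (1 ≤_) (sym (Kᵗ-∷ y w)) (K-pos w)

Kᵗ≤K : ∀ {n} (v : Vec ℕ n) → Kᵗ v ≤ K v
Kᵗ≤K []      = z≤n
Kᵗ≤K (y ∷ w) = begin
  Kᵗ (y ∷ w)          ≡⟨ Kᵗ-∷ y w ⟩
  K w                 ≤⟨ m≤m+n (K w) (y · K w) ⟩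
  suc y · K w         ≤⟨ m≤m+n (suc y · K w) (Kᵗ w) ⟩
  suc y · K w + Kᵗ w  ≡⟨ sym (K-∷ y w) ⟩
  K (y ∷ w)           ∎
  where open ≤-Reasoning

K-∷ʳ-≥ : ∀ {n} (w : Vec ℕ n) y → suc y · K w ≤ K (w ∷ʳ y)
K-∷ʳ-≥ w y = subst (suc y · K w ≤_) (sym (K-∷ʳ w y)) (m≤m+n (suc y · K w) (K⁻ w))

K-∷-≥ : ∀ {n} x (v : Vec ℕ n) → suc x · K v ≤ K (x ∷ v)
K-∷-≥ x v = subst (suc x · K v ≤_) (sym (K-∷ x v)) (m≤m+n (suc x · K v) (Kᵗ v))

-- The hypothesis on the end entries, on predecessors: both ends ≥ 2, or both equal 1.
Ends : ℕ → ℕ → Set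
Ends x y = (1 ≤ x × 1 ≤ y) ⊎ (x ≡ 0 × y ≡ 0)

anticontinuant-bound : ∀ {n} x (u : Vec ℕ n) y → Ends x y →
  2 · ∣ K (x ∷ u) - K (u ∷ʳ y) ∣ <ℕ K (x ∷ (u ∷ʳ y))
anticontinuant-bound x u y (inj₁ (1≤x , 1≤y)) = gap-outer (K-pos (x ∷ u)) (K-pos (u ∷ʳ y))
  (≤-trans (*-monoˡ-≤ (K (x ∷ u)) (s≤s 1≤y)) (K-∷ʳ-≥ (x ∷ u) y))
  (≤-trans (*-monoˡ-≤ (K (u ∷ʳ y)) (s≤s 1≤x)) (K-∷-≥ x (u ∷ʳ y)))
anticontinuant-bound _ u _ (inj₂ (refl , refl)) = gap-inner
  (trans (K-∷ʳ (0 ∷ u) 0) (cong (_+ K⁻ (0 ∷ u)) (*-identityˡ (K (0 ∷ u)))))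
  (trans (K-∷ 0 (u ∷ʳ 0)) (cong (_+ Kᵗ (u ∷ʳ 0)) (*-identityˡ (K (u ∷ʳ 0)))))
  (K⁻-pos 0 u) (K⁻≤K (0 ∷ u)) (Kᵗ-pos (u ∷ʳ 0)) (Kᵗ≤K (u ∷ʳ 0))

run-ℤ : ∀ {n} (v : Vec ℕ n) a b →
  foldl (λ _ → ℤ × ℤ) contStep (+ a , + b) (map +[1+_] v)
    ≡ (+ proj₁ (run (a , b) v) , + proj₂ (run (a , b) v))
run-ℤ []      a b = refl
run-ℤ (q ∷ v) a b = trans
  (cong (λ c → foldl (λ _ → ℤ × ℤ) contStep (c , + a) (map +[1+_] v)) (sym cast-step))
  (run-ℤ v (suc q · a + b) a)
  where
  cast-step : + (suc q · a + b) ≡ +[1+ q ] * + a ℤ.+ + b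
  cast-step = trans (pos-+ (suc q · a) b) (cong (ℤ._+ + b) (pos-* (suc q) a))

continuant-ℕ : ∀ {n} (v : Vec ℕ n) → continuant (map +[1+_] v) ≡ + K v
continuant-ℕ v = cong proj₁ (run-ℤ v 1 0)

init-map-∷ʳ : ∀ {A B : Set} {n} (f : A → B) (w : Vec A n) y → init (map f (w ∷ʳ y)) ≡ map f w
init-map-∷ʳ f w y = trans (cong init (map-∷ʳ f y w)) (init-∷ʳ (f y) (map f w))

last-map-∷ʳ : ∀ {A B : Set} {n} (f : A → B) (w : Vec A n) y → last (map f (w ∷ʳ y)) ≡ f y
last-map-∷ʳ f w y = trans (cong last (map-∷ʳ f y w)) (last-∷ʳ (f y) (map f w))

anticontinuant-ℕ : ∀ {n} x (u : Vec ℕ n) y →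
  anticontinuant (map +[1+_] (x ∷ (u ∷ʳ y))) ≡ + K (x ∷ u) ℤ.- + K (u ∷ʳ y)
anticontinuant-ℕ x u y = cong₂ ℤ._-_
  (trans (cong continuant (init-map-∷ʳ +[1+_] (x ∷ u) y)) (continuant-ℕ (x ∷ u)))
  (continuant-ℕ (u ∷ʳ y))

∣m⊖n∣≡∣m-n∣ : ∀ m n → ∣ m ⊖ n ∣ ≡ ∣ m - n ∣
∣m⊖n∣≡∣m-n∣ zero    zero    = refl
∣m⊖n∣≡∣m-n∣ zero    (suc n) = refl
∣m⊖n∣≡∣m-n∣ (suc m) zero    = refl
∣m⊖n∣≡∣m-n∣ (suc m) (suc n) = trans (cong ∣_∣ ([1+m]⊖[1+n]≡m⊖n m n)) (∣m⊖n∣≡∣m-n∣ m n)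

cast-bound : ∀ A B K → 2 · ∣ A - B ∣ <ℕ K → + 2 * + ∣ + A ℤ.- + B ∣ < + K
cast-bound A B K h
  rewrite [+m]-[+n]≡m⊖n A B | ∣m⊖n∣≡∣m-n∣ A B | sym (pos-* 2 ∣ A - B ∣) = +<+ h

ends-ℕ : ∀ {x y} → (+[1+ x ] ≥ + 2 × +[1+ y ] ≥ + 2) ⊎ (+[1+ x ] ≡ + 1 × +[1+ y ] ≡ + 1) →
  Ends x y
ends-ℕ (inj₁ (+≤+ (s≤s 1≤x) , +≤+ (s≤s 1≤y))) = inj₁ (1≤x , 1≤y)
ends-ℕ (inj₂ (refl , refl))                     = inj₂ (refl , refl)

proposition4 : (m : ℕ) (q : Vec ℕ (suc m)) →
    let qz = map +[1+_] q in
    ((head qz ≥ + 2 × last qz ≥ + 2) ⊎ (head qz ≡ + 1 × last qz ≡ + 1)) →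
    + 2 * + ∣ anticontinuant qz ∣ < continuant qz
-- For m = 0 the anticontinuant is [ ] - [ ] = 0; otherwise split off both end entries.
proposition4 zero    (x ∷ []) _    = +<+ (s≤s z≤n)
proposition4 (suc m) (x ∷ t)  ends with initLast t
... | u , y , refl = begin-strict
  + 2 * + ∣ anticontinuant qz ∣
    ≡⟨ cong (λ d → + 2 * + ∣ d ∣) (anticontinuant-ℕ x u y) ⟩
  + 2 * + ∣ + K (x ∷ u) ℤ.- + K (u ∷ʳ y) ∣
    <⟨ cast-bound (K (x ∷ u)) (K (u ∷ʳ y)) _ (anticontinuant-bound x u y ends′) ⟩
  + K (x ∷ (u ∷ʳ y))
    ≡⟨ sym (continuant-ℕ (x ∷ (u ∷ʳ y))) ⟩
  continuant qz
    ∎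
  where
  open ℤP.≤-Reasoning
  qz : Vec ℤ (suc (suc m))
  qz = map +[1+_] (x ∷ (u ∷ʳ y))
  ends′ : Ends x y
  ends′ = ends-ℕ (subst (λ l → (+[1+ x ] ≥ + 2 × l ≥ + 2) ⊎ (+[1+ x ] ≡ + 1 × l ≡ + 1))
                        (last-map-∷ʳ +[1+_] (x ∷ u) y) ends)
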